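{- Let $\Psi$ be a normal-form sentence of $\mathrm{FO}^2_T$ with transitive witnesses, $\mathfrak A\models\Psi$, and let $B,B_1$ be distinct cliques of $\mathfrak A$ with $sp^{\mathfrak A}(B_1)=sp^{\mathfrak A}(B)$. Let $\mathfrak A^{+B}$ be the structure defined in the context, with new clique $D$. Then: (1) $\mathfrak A^{+B}\models\Psi$; (2) for every $i\le m$ and every $a\in A\setminus B$: if $W_i^{\mathfrak A}(a)\cap B\neq\emptyset$ then $W_i^{\mathfrak A^{+B}}(a)\cap D\neq\emptyset$; (3) $sp^{\mathfrak A^{+B}}(D)=sp^{\mathfrak A^{+B}}(B)=sp^{\mathfrak A}(B)$; (4) $\mathcal B^{\mathfrak A^{+B}}[D,B]=\mathcal B^{\mathfrak A^{+B}}[B_1,B]=\mathcal B^{\mathfrak A}[B_1,B]$; (5) $\mathcal B^{\mathfrak A^{+B}}[D,X]=\mathcal B^{\mathfrak A^{+B}}[B,X]=\mathcal B^{\mathfrak A}[B,X]$ for every clique $X$ of $\mathfrak A^{+B}$ with $X\neq B$, $X\neq D$.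
   Context: Signatures are relational (arity at most 2) with a distinguished binary $T$ interpreted transitively in models. For quantifier-free $\psi(x,y)$: $\psi^{\rightarrow}:=Txy\wedge\neg Tyx\wedge\psi$, $\psi^{\leftarrow}:=\neg Txy\wedge Tyx\wedge\psi$, $\psi^{\leftrightarrow}:=Txy\wedge Tyx\wedge\psi$. $\Psi=\forall x\forall y\,\psi_0\wedge\bigwedge_{i=1}^m\gamma_i\wedge\bigwedge_{i=1}^{\bar m}\delta_i$, $\gamma_i=\forall x\exists y\,\psi_i^{d_i}(x,y)$ with $d_i\in\{\rightarrow,\leftarrow\}$, $\delta_i=\forall x\exists y\,\psi_i^{\leftrightarrow}(x,y)$, $\psi_i$ quantifier-free. $tp^{\mathfrak A}[a]$ is the 1-type and, for $a\ne b$, $tp^{\mathfrak A}[a,b]$ the 2-type. For $X,Y\subseteq A$, $\mathcal B^{\mathfrak A}[X,Y]=\{tp^{\mathfrak A}[x,y]:x\in X,y\in Y\}$. A set is $T$-connected if $Tbc$ holds for all distinct members; cliques are maximal $T$-connected sets. For distinct elements $b<c$ iff $Tbc\wedge\neg Tcb$; $b<C$ iff $b<c$ for all $c\in C$, similarly $C<b$. The splice $sp^{\mathfrak A}(B)$ of a clique $B$ is $(\text{isomorphism type of }\mathfrak A\restriction B,\ \{tp^{\mathfrak A}[a]: a<B\},\ \{tp^{\mathfrak A}[a]: B<a\})$. $W_i^{\mathfrak A}(a)=\{b\ne a:\mathfrak A\models\psi_i^{d_i}[a,b]\}$. Construction of $\mathfrak A^{+B}$: let $D$ be a set disjoint from $A$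 carrying a copy $\mathfrak D$ of $\mathfrak A\restriction B$, with isomorphisms $f:\mathfrak D\to\mathfrak A\restriction B$ and $f_1:\mathfrak D\to\mathfrak A\restriction B_1$. $\mathfrak A^{+B}$ has universe $A\cup D$, $\mathfrak A^{+B}\restriction A=\mathfrak A$, $\mathfrak A^{+B}\restriction D=\mathfrak D$, and for $d\in D$: $tp^{\mathfrak A^{+B}}[d,b]=tp^{\mathfrak A}[f_1(d),b]$ for $b\in B$, and $tp^{\mathfrak A^{+B}}[d,a]=tp^{\mathfrak A}[f(d),a]$ for $a\in A\setminus B$. -}

module Defs where

open import Data.Nat using (ℕ; suc)
open import Data.Fin using (Fin; zero)
open import Data.Bool using (Bool; true; false; if_then_else_)
open import Data.Vec using (Vec; tabulate)
open import Data.Product using (Σ; ∃; ∃-syntax; _×_; _,_; proj₁)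
open import Data.Sum using (_⊎_; inj₁; inj₂)
open import Relation.Binary.PropositionalEquality using (_≡_; _≢_; refl)
open import Relation.Nullary using (¬_)

record Sig : Set where
  field
    n0 n1 nB : ℕ

open Sig public

Bin : Sig → Set
Bin σ = Fin (suc (nB σ))

Tsym : ∀ {σ} → Bin σ
Tsym = zero

record Str (σ : Sig) : Set₁ where
  field
    Carrier : Set
    P0 : Fin (n0 σ) → Bool
    P1 : Fin (n1 σ) → Carrier → Bool
    P2 : Bin σ → Carrier → Carrier → Bool

open Str public

module _ {σ : Sig} (𝔄 : Str σ) where

  T : Carrier 𝔄 → Carrier 𝔄 → Bool
  T = P2 𝔄 (Tsym {σ})

  Transitive : Set
  Transitive = ∀ a b c → T a b ≡ true → T b c ≡ true → T a c ≡ true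

  Subset : Set
  Subset = Carrier 𝔄 → Bool

  El : Subset → Set
  El X = Σ (Carrier 𝔄) (λ a → X a ≡ true)

  full : Subset
  full _ = true

  _≺_ : Carrier 𝔄 → Carrier 𝔄 → Set
  b ≺ c = T b c ≡ true × T c b ≡ false

  TConnected : Subset → Set
  TConnected X = ∀ b c → X b ≡ true → X c ≡ true → b ≢ c → T b c ≡ true

  IsClique : Subset → Set
  IsClique X = TConnected X ×
    (∀ (Y : Subset) → TConnected Y → (∀ a → X a ≡ true → Y a ≡ true) →
       ∀ a → Y a ≡ true → X a ≡ true)

Distinct : ∀ {σ} (𝔄 : Str σ) → Subset 𝔄 → Subset 𝔄 → Set
Distinct 𝔄 X Y = ¬ (∀ a → X a ≡ Y a)

Type1 : Sig → Set
Type1 σ = Vec Bool (n0 σ) × Vec Bool (n1 σ) × Vec Bool (suc (nB σ))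

Type2 : Sig → Set
Type2 σ = Type1 σ × Type1 σ × Vec Bool (suc (nB σ)) × Vec Bool (suc (nB σ))

tp1 : ∀ {σ} (𝔄 : Str σ) → Carrier 𝔄 → Type1 σ
tp1 𝔄 a = tabulate (P0 𝔄) , tabulate (λ i → P1 𝔄 i a) , tabulate (λ r → P2 𝔄 r a a)

tp2 : ∀ {σ} (𝔄 : Str σ) → Carrier 𝔄 → Carrier 𝔄 → Type2 σ
tp2 𝔄 a b = tp1 𝔄 a , tp1 𝔄 b , tabulate (λ r → P2 𝔄 r a b) , tabulate (λ r → P2 𝔄 r b a)

_≐_ : {Ty : Set} → (Ty → Set) → (Ty → Set) → Set
S ≐ S' = ∀ t → (S t → S' t) × (S' t → S t)

𝓑 : ∀ {σ} (𝔄 : Str σ) → Subset 𝔄 → Subset 𝔄 → Type2 σ → Set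
𝓑 𝔄 X Y t = ∃[ x ] ∃[ y ] (X x ≡ true × Y y ≡ true × x ≢ y × tp2 𝔄 x y ≡ t)

record Iso {σ} (𝔄 : Str σ) (X : Subset 𝔄) (𝔅 : Str σ) (Y : Subset 𝔅) : Set where
  field
    to   : El 𝔄 X → El 𝔅 Y
    from : El 𝔅 Y → El 𝔄 X
    from-to : ∀ p → proj₁ (from (to p)) ≡ proj₁ p
    to-from : ∀ q → proj₁ (to (from q)) ≡ proj₁ q
    pres0 : ∀ i → P0 𝔅 i ≡ P0 𝔄 i
    pres1 : ∀ i p → P1 𝔅 i (proj₁ (to p)) ≡ P1 𝔄 i (proj₁ p)
    pres2 : ∀ r p q → P2 𝔅 r (proj₁ (to p)) (proj₁ (to q)) ≡ P2 𝔄 r (proj₁ p) (proj₁ q)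

-- Splices: sp(B) = (iso type of 𝔄↾B, {tp[a] : a < B}, {tp[a] : B < a}).
-- Equality of splices, possibly across two structures.

Below : ∀ {σ} (𝔄 : Str σ) → Subset 𝔄 → Type1 σ → Set
Below 𝔄 X t = ∃[ a ] ((∀ c → X c ≡ true → _≺_ 𝔄 a c) × tp1 𝔄 a ≡ t)

Above : ∀ {σ} (𝔄 : Str σ) → Subset 𝔄 → Type1 σ → Set
Above 𝔄 X t = ∃[ a ] ((∀ c → X c ≡ true → _≺_ 𝔄 c a) × tp1 𝔄 a ≡ t)

SpEq : ∀ {σ} (𝔄 : Str σ) → Subset 𝔄 → (𝔅 : Str σ) → Subset 𝔅 → Set
SpEq 𝔄 X 𝔅 Y = Iso 𝔄 X 𝔅 Y × (Below 𝔄 X ≐ Below 𝔅 Y) × (Above 𝔄 X ≐ Above 𝔅 Y)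

data Var : Set where
  vx vy : Var

data QF (σ : Sig) : Set where
  ⊤ᶠ    : QF σ
  at0   : Fin (n0 σ) → QF σ
  at1   : Fin (n1 σ) → Var → QF σ
  at2   : Bin σ → Var → Var → QF σ
  eqᶠ   : Var → Var → QF σ
  ¬ᶠ_   : QF σ → QF σ
  _∧ᶠ_  : QF σ → QF σ → QF σ
  _∨ᶠ_  : QF σ → QF σ → QF σ

⟦_⟧ : ∀ {σ} → QF σ → (𝔄 : Str σ) → Carrier 𝔄 → Carrier 𝔄 → Set
⟦ φ ⟧ 𝔄 a b = go φ
  where
  val : Var → Carrier 𝔄
  val vx = a
  val vy = b
  go : _ → Set
  go ⊤ᶠ = Data.Unit.⊤ where import Data.Unit
  go (at0 p) = P0 𝔄 p ≡ true
  go (at1 p v) = P1 𝔄 p (val v) ≡ true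
  go (at2 r v w) = P2 𝔄 r (val v) (val w) ≡ true
  go (eqᶠ v w) = val v ≡ val w
  go (¬ᶠ φ) = ¬ go φ
  go (φ ∧ᶠ ψ) = go φ × go ψ
  go (φ ∨ᶠ ψ) = go φ ⊎ go ψ

data Dir : Set where
  ⇒ ⇐ : Dir

_^→ _^← _^↔ : ∀ {σ} → QF σ → QF σ
_^→ {σ} ψ = at2 (Tsym {σ}) vx vy ∧ᶠ ((¬ᶠ at2 (Tsym {σ}) vy vx) ∧ᶠ ψ)
_^← {σ} ψ = (¬ᶠ at2 (Tsym {σ}) vx vy) ∧ᶠ (at2 (Tsym {σ}) vy vx ∧ᶠ ψ)
_^↔ {σ} ψ = at2 (Tsym {σ}) vx vy ∧ᶠ (at2 (Tsym {σ}) vy vx ∧ᶠ ψ)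

_^[_] : ∀ {σ} → QF σ → Dir → QF σ
ψ ^[ ⇒ ] = ψ ^→
ψ ^[ ⇐ ] = ψ ^←

record NF (σ : Sig) : Set where
  field
    ψ0 : QF σ
    m  : ℕ
    γψ : Fin m → QF σ
    d  : Fin m → Dir
    m̄  : ℕ
    δψ : Fin m̄ → QF σ

open NF public

_⊨_ : ∀ {σ} → Str σ → NF σ → Set
𝔄 ⊨ Ψ = Transitive 𝔄
  × (∀ a b → ⟦ ψ0 Ψ ⟧ 𝔄 a b)
  × (∀ i a → ∃[ b ] ⟦ γψ Ψ i ^[ d Ψ i ] ⟧ 𝔄 a b)
  × (∀ i a → ∃[ b ] ⟦ δψ Ψ i ^↔ ⟧ 𝔄 a b)

W : ∀ {σ} (Ψ : NF σ) (𝔄 : Str σ) → Fin (m Ψ) → Carrier 𝔄 → Carrier 𝔄 → Set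
W Ψ 𝔄 i a b = b ≢ a × ⟦ γψ Ψ i ^[ d Ψ i ] ⟧ 𝔄 a b

Meets : ∀ {σ} (Ψ : NF σ) (𝔄 : Str σ) → Fin (m Ψ) → Carrier 𝔄 → Subset 𝔄 → Set
Meets Ψ 𝔄 i a X = ∃[ b ] (X b ≡ true × W Ψ 𝔄 i a b)

module Plus {σ} (𝔄 : Str σ) (B : Subset 𝔄) (𝔇 : Str σ) {B1 : Subset 𝔄}
            (f : Iso 𝔇 (full 𝔇) 𝔄 B) (f1 : Iso 𝔇 (full 𝔇) 𝔄 B1) where

  fm : Carrier 𝔇 → Carrier 𝔄
  fm x = proj₁ (Iso.to f (x , refl))

  f1m : Carrier 𝔇 → Carrier 𝔄
  f1m x = proj₁ (Iso.to f1 (x , refl))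

  p1 : Fin (n1 σ) → Carrier 𝔄 ⊎ Carrier 𝔇 → Bool
  p1 i (inj₁ a) = P1 𝔄 i a
  p1 i (inj₂ x) = P1 𝔇 i x

  p2 : Bin σ → Carrier 𝔄 ⊎ Carrier 𝔇 → Carrier 𝔄 ⊎ Carrier 𝔇 → Bool
  p2 r (inj₁ a) (inj₁ a') = P2 𝔄 r a a'
  p2 r (inj₂ x) (inj₂ x') = P2 𝔇 r x x'
  p2 r (inj₂ x) (inj₁ a) = if B a then P2 𝔄 r (f1m x) a else P2 𝔄 r (fm x) a
  p2 r (inj₁ a) (inj₂ x) = if B a then P2 𝔄 r a (f1m x) else P2 𝔄 r a (fm x)

  𝔄⁺ : Str σ
  𝔄⁺ = record { Carrier = Carrier 𝔄 ⊎ Carrier 𝔇 ; P0 = P0 𝔄 ; P1 = p1 ; P2 = p2 }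

  Dˢ : Subset 𝔄⁺
  Dˢ (inj₁ _) = false
  Dˢ (inj₂ _) = true

  lift : Subset 𝔄 → Subset 𝔄⁺
  lift X (inj₁ a) = X a
  lift X (inj₂ _) = false

  restrict : Subset 𝔄⁺ → Subset 𝔄
  restrict X a = X (inj₁ a)

-- Two maps ρ true, ρ false : 𝔄^{+B} → 𝔄 fix A and send the new clique D onto B1 via f1,
-- respectively onto B via f. ρ (B a) is an isomorphism on every pair {d, a} with d ∈ D, and both
-- maps are isomorphisms on pairs inside A and inside D, so each pair of 𝔄^{+B} is seen faithfully
-- by one of them. Hence quantifier-free formulas, 2-types and the order < of 𝔄^{+B} are read off
-- from 𝔄, witnesses are pulled back along the appropriate map, and the sets of 1- and 2-types in
-- (3)-(5) are images of the corresponding sets of 𝔄. No single map sees a chain d, a, b with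
-- exactly one of a, b in B; transitivity there holds because an element lying T-between two
-- members of the clique B belongs to B.
module Submission where

open import Defs
open import Data.Product using (_×_)
open import Relation.Binary.PropositionalEquality using (_≡_)
open import Data.Bool using (true; false)
open import Data.Fin using (Fin)
open import Data.Sum using (inj₁)

open import Axiom.UniquenessOfIdentityProofs.WithK using (uip)
open import Data.Bool using (Bool; _∧_; _≟_)
open import Data.Bool.Properties using (¬-not; not-¬)
open import Data.Empty using (⊥; ⊥-elim)
open import Data.Product using (Σ; ∃-syntax; _,_; proj₁; proj₂; swap)
open import Data.Product.Function.NonDependent.Propositional using (_×-⇔_)
open import Data.Sum using (inj₂)
open import Data.Sum.Function.Propositional using (_⊎-⇔_)
open import Data.Unit using (⊤; tt)
open import Data.Vec.Properties using (tabulate-cong)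
open import Function using (_∘_; case_of_)
open import Function.Bundles using (_⇔_; mk⇔; Equivalence)
open import Function.Construct.Identity using (⇔-id)
open import Function.Related.TypeIsomorphisms using (¬-cong-⇔)
open import Relation.Binary.PropositionalEquality
  using (_≢_; refl; sym; trans; cong; cong₂; subst; module ≡-Reasoning)
open import Relation.Nullary using (¬_; yes; no)
open import Relation.Nullary.Decidable using (decidable-stable; ¬¬-excluded-middle)

open Equivalence using (to; from)

-- Carriers have no decidable equality, but Bool-valued goals are stable under double negation.
by-cases-on-≡ : {A : Set} {x y : A} {b : Bool} → (x ≡ y → b ≡ true) → (x ≢ y → b ≡ true) → b ≡ true
by-cases-on-≡ {b = b} equal unequal = decidable-stable (b ≟ true) λ b≢true →
  ¬¬-excluded-middle λ { (yes e) → b≢true (equal e) ; (no ne) → b≢true (unequal ne) }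

∧-≡true⁺ : ∀ {p q} → p ≡ true → q ≡ true → p ∧ q ≡ true
∧-≡true⁺ refl refl = refl

∧-≡true⁻ : ∀ {p q} → p ∧ q ≡ true → p ≡ true × q ≡ true
∧-≡true⁻ {true} {true} _ = refl , refl

≡⇒≡true-⇔ : ∀ {x y : Bool} → x ≡ y → (x ≡ true) ⇔ (y ≡ true)
≡⇒≡true-⇔ e = mk⇔ (trans (sym e)) (trans e)

≡⇒≡false-⇔ : ∀ {x y : Bool} → x ≡ y → (x ≡ false) ⇔ (y ≡ false)
≡⇒≡false-⇔ e = mk⇔ (trans (sym e)) (trans e)

El-≡ : {A : Set} {X : A → Bool} {p q : Σ A λ a → X a ≡ true} → proj₁ p ≡ proj₁ q → p ≡ q
El-≡ {p = _ , Xa} {_ , Xb} refl = cong (_ ,_) (uip Xa Xb)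

≐-sym : {Ty : Set} {S S' : Ty → Set} → S ≐ S' → S' ≐ S
≐-sym S≐S' t = swap (S≐S' t)

≐-trans : {Ty : Set} {S S' S'' : Ty → Set} → S ≐ S' → S' ≐ S'' → S ≐ S''
≐-trans S≐S' S'≐S'' t = proj₁ (S'≐S'' t) ∘ proj₁ (S≐S' t) , proj₂ (S≐S' t) ∘ proj₂ (S'≐S'' t)

module _ {σ : Sig} where

  Linked : (𝔐 : Str σ) → Carrier 𝔐 → Carrier 𝔐 → Set
  Linked 𝔐 a b = T 𝔐 a b ≡ true × T 𝔐 b a ≡ true

  Precedes : (𝔐 : Str σ) → Dir → Carrier 𝔐 → Carrier 𝔐 → Set
  Precedes 𝔐 ⇒ a c = _≺_ 𝔐 a c
  Precedes 𝔐 ⇐ a c = _≺_ 𝔐 c a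

  -- Bound ⇒ is Below and Bound ⇐ is Above, definitionally.
  Bound : Dir → (𝔐 : Str σ) → Subset 𝔐 → Type1 σ → Set
  Bound dir 𝔐 X t = ∃[ a ] ((∀ c → X c ≡ true → Precedes 𝔐 dir a c) × tp1 𝔐 a ≡ t)

  Precedes-irrefl : ∀ {𝔐 : Str σ} dir {a} → ¬ Precedes 𝔐 dir a a
  Precedes-irrefl ⇒ (Taa , ¬Taa) = not-¬ Taa ¬Taa
  Precedes-irrefl ⇐ (Taa , ¬Taa) = not-¬ Taa ¬Taa

  Bound-∉ : ∀ {𝔐 : Str σ} {X : Subset 𝔐} dir {a}
          → (∀ c → X c ≡ true → Precedes 𝔐 dir a c) → X a ≡ false
  Bound-∉ {𝔐} dir {a} below = ¬-not λ Xa → Precedes-irrefl {𝔐} dir (below a Xa)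

module _ {σ : Sig} where

  Iso-sym : {𝔄 𝔅 : Str σ} {X : Subset 𝔄} {Y : Subset 𝔅} → Iso 𝔄 X 𝔅 Y → Iso 𝔅 Y 𝔄 X
  Iso-sym {𝔅 = 𝔅} i = record
    { to = I.from ; from = I.to ; from-to = I.to-from ; to-from = I.from-to
    ; pres0 = λ k → sym (I.pres0 k)
    ; pres1 = λ k q → trans (sym (I.pres1 k (I.from q))) (cong (P1 𝔅 k) (I.to-from q))
    ; pres2 = λ r p q → trans (sym (I.pres2 r (I.from p) (I.from q)))
                              (cong₂ (P2 𝔅 r) (I.to-from p) (I.to-from q)) }
    where module I = Iso i

  Iso-trans : {𝔄 𝔅 ℭ : Str σ} {X : Subset 𝔄} {Y : Subset 𝔅} {Z : Subset ℭ}
            → Iso 𝔄 X 𝔅 Y → Iso 𝔅 Y ℭ Z → Iso 𝔄 X ℭ Z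
  Iso-trans i j = record
    { to = J.to ∘ I.to ; from = I.from ∘ J.from
    ; from-to = λ p → trans (cong (proj₁ ∘ I.from) (El-≡ (J.from-to (I.to p)))) (I.from-to p)
    ; to-from = λ q → trans (cong (proj₁ ∘ J.to) (El-≡ (I.to-from (J.from q)))) (J.to-from q)
    ; pres0 = λ k → trans (J.pres0 k) (I.pres0 k)
    ; pres1 = λ k p → trans (J.pres1 k (I.to p)) (I.pres1 k p)
    ; pres2 = λ r p q → trans (J.pres2 r (I.to p) (I.to q)) (I.pres2 r p q) }
    where module I = Iso i
          module J = Iso j

  module FullIso {𝔇 𝔄 : Str σ} {X : Subset 𝔄} (g : Iso 𝔇 (full 𝔇) 𝔄 X) where
    module G = Iso g

    ι : Carrier 𝔇 → Carrier 𝔄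
    ι x = proj₁ (G.to (x , refl))

    ι∈ : ∀ x → X (ι x) ≡ true
    ι∈ x = proj₂ (G.to (x , refl))

    ι-injective : ∀ {x y} → ι x ≡ ι y → x ≡ y
    ι-injective {x} {y} e = begin
      x                               ≡⟨ sym (G.from-to (x , refl)) ⟩
      proj₁ (G.from (G.to (x , refl))) ≡⟨ cong (proj₁ ∘ G.from) (El-≡ e) ⟩
      proj₁ (G.from (G.to (y , refl))) ≡⟨ G.from-to (y , refl) ⟩
      y                               ∎
      where open ≡-Reasoning

    ι-surjective : ∀ {b} → X b ≡ true → ∃[ x ] ι x ≡ b
    ι-surjective {b} Xb =
      proj₁ (G.from (b , Xb)) , trans (cong (proj₁ ∘ G.to) (El-≡ refl)) (G.to-from (b , Xb))

    ι-pres1 : ∀ i x → P1 𝔄 i (ι x) ≡ P1 𝔇 i x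
    ι-pres1 i x = G.pres1 i (x , refl)

    ι-pres2 : ∀ r x y → P2 𝔄 r (ι x) (ι y) ≡ P2 𝔇 r x y
    ι-pres2 r x y = G.pres2 r (x , refl) (y , refl)

  SpEq-bound : {𝔄 𝔅 : Str σ} {X : Subset 𝔄} {Y : Subset 𝔅}
             → SpEq 𝔄 X 𝔅 Y → ∀ dir → Bound dir 𝔄 X ≐ Bound dir 𝔅 Y
  SpEq-bound (_ , below , _) ⇒ = below
  SpEq-bound (_ , _ , above) ⇐ = above

  SpEq-sym : {𝔄 𝔅 : Str σ} {X : Subset 𝔄} {Y : Subset 𝔅} → SpEq 𝔄 X 𝔅 Y → SpEq 𝔅 Y 𝔄 X
  SpEq-sym (i , below , above) = Iso-sym i , ≐-sym below , ≐-sym above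

  SpEq-trans : {𝔄 𝔅 ℭ : Str σ} {X : Subset 𝔄} {Y : Subset 𝔅} {Z : Subset ℭ}
             → SpEq 𝔄 X 𝔅 Y → SpEq 𝔅 Y ℭ Z → SpEq 𝔄 X ℭ Z
  SpEq-trans (i , below , above) (j , below' , above') =
    Iso-trans i j , ≐-trans below below' , ≐-trans above above'

module _ {σ : Sig} (𝔐 : Str σ) where

  T-connectedˡ : ∀ {X} → TConnected 𝔐 X → Transitive 𝔐
               → ∀ {x y z} → X x ≡ true → X y ≡ true → T 𝔐 y z ≡ true → T 𝔐 x z ≡ true
  T-connectedˡ connected T-trans {x} {y} {z} Xx Xy Tyz = by-cases-on-≡ {x = x} {y}
    (λ { refl → Tyz })
    (λ x≢y → T-trans x y z (connected x y Xx Xy x≢y) Tyz)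

  T-connectedʳ : ∀ {X} → TConnected 𝔐 X → Transitive 𝔐
               → ∀ {x y z} → X y ≡ true → X z ≡ true → T 𝔐 x y ≡ true → T 𝔐 x z ≡ true
  T-connectedʳ connected T-trans {x} {y} {z} Xy Xz Txy = by-cases-on-≡ {x = y} {z}
    (λ { refl → Txy })
    (λ y≢z → T-trans x y z Txy (connected y z Xy Xz y≢z))

  T-connected-sym : ∀ {X} → TConnected 𝔐 X
                  → ∀ {a b} → X a ≡ true → X b ≡ true → T 𝔐 a b ≡ true → T 𝔐 b a ≡ true
  T-connected-sym connected {a} {b} Xa Xb Tab = by-cases-on-≡ {x = a} {b}
    (λ { refl → Tab })
    (λ a≢b → connected b a Xb Xa (a≢b ∘ sym))

  strict-witness-∉ : ∀ {X} → TConnected 𝔐 X → ∀ dir ψ {a b}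
                   → ⟦ ψ ^[ dir ] ⟧ 𝔐 a b → X a ≡ true → X b ≡ false
  strict-witness-∉ connected ⇒ ψ (Tab , ¬Tba , _) Xa =
    ¬-not λ Xb → ¬Tba (T-connected-sym connected Xa Xb Tab)
  strict-witness-∉ connected ⇐ ψ (¬Tab , Tba , _) Xa =
    ¬-not λ Xb → ¬Tab (T-connected-sym connected Xb Xa Tba)

  clique-intro : ∀ {X} → TConnected 𝔐 X
               → (∀ a → (∀ b → X b ≡ true → b ≢ a → Linked 𝔐 a b) → X a ≡ true)
               → IsClique 𝔐 X
  clique-intro connected closed = connected , λ Y Y-connected X⊆Y a Ya → closed a λ b Xb b≢a →
    Y-connected a b Ya (X⊆Y b Xb) (b≢a ∘ sym) , Y-connected b a (X⊆Y b Xb) Ya b≢a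

  module _ (T-trans : Transitive 𝔐) where

    -- The witness w is only needed to get T a a: then {x | T x a ∧ T a x} is T-connected.
    clique-absorb : ∀ {X} → IsClique 𝔐 X → ∀ {w a} → X w ≡ true
                  → (∀ b → X b ≡ true → b ≢ a → Linked 𝔐 a b) → X a ≡ true
    clique-absorb {X} (_ , maximal) {w} {a} Xw linked = by-cases-on-≡ {x = w} {a}
      (λ { refl → Xw })
      (λ w≢a → let (Taw , Twa) = linked w Xw w≢a
                   Taa = T-trans a w a Taw Twa
               in maximal Y Y-connected (X⊆Y Taa) a (∧-≡true⁺ Taa Taa))
      where
      Y : Subset 𝔐
      Y x = T 𝔐 x a ∧ T 𝔐 a x

      Y-connected : TConnected 𝔐 Y
      Y-connected x y Yx Yy _ = T-trans x a y (proj₁ (∧-≡true⁻ Yx)) (proj₂ (∧-≡true⁻ Yy))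

      X⊆Y : T 𝔐 a a ≡ true → ∀ x → X x ≡ true → Y x ≡ true
      X⊆Y Taa x Xx = by-cases-on-≡ {x = x} {a}
        (λ { refl → ∧-≡true⁺ Taa Taa })
        (λ x≢a → let (Tax , Txa) = linked x Xx x≢a in ∧-≡true⁺ Txa Tax)

    clique-convex : ∀ {X} → IsClique 𝔐 X → ∀ {b c b'} → X b ≡ true → X b' ≡ true
                  → T 𝔐 b c ≡ true → T 𝔐 c b' ≡ true → X c ≡ true
    clique-convex X-clique@(connected , _) Xb Xb' Tbc Tcb' = clique-absorb X-clique Xb λ x Xx _ →
      T-connectedʳ connected T-trans Xb' Xx Tcb' , T-connectedˡ connected T-trans Xx Xb Tbc

    private
      T-across : ∀ {X Y} → TConnected 𝔐 X → TConnected 𝔐 Y → ∀ {c a b}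
               → X c ≡ true → Y c ≡ true → X a ≡ true → Y b ≡ true → a ≢ b → T 𝔐 a b ≡ true
      T-across X-connected Y-connected {c} {a} {b} Xc Yc Xa Yb a≢b = by-cases-on-≡ {x = c} {b}
        (λ { refl → X-connected a c Xa Xc a≢b })
        (λ c≢b → T-connectedˡ X-connected T-trans Xa Xc (Y-connected c b Yc Yb c≢b))

    clique-⊆ : ∀ {X Y} → IsClique 𝔐 X → IsClique 𝔐 Y → ∀ {c} → X c ≡ true → Y c ≡ true
             → ∀ a → Y a ≡ true → X a ≡ true
    clique-⊆ X-clique@(X-connected , _) (Y-connected , _) Xc Yc a Ya =
      clique-absorb X-clique Xc λ b Xb b≢a →
        T-across Y-connected X-connected Yc Xc Ya Xb (b≢a ∘ sym) ,
        T-across X-connected Y-connected Xc Yc Xb Ya b≢a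

    cliques-meeting-coincide : ∀ {X Y} → IsClique 𝔐 X → IsClique 𝔐 Y → ∀ {c}
                             → X c ≡ true → Y c ≡ true → ∀ a → X a ≡ Y a
    cliques-meeting-coincide {X} {Y} X-clique Y-clique Xc Yc a with X a in Xa | Y a in Ya
    ... | true  | true  = refl
    ... | false | false = refl
    ... | true  | false = ⊥-elim (not-¬ (clique-⊆ Y-clique X-clique Yc Xc a Xa) Ya)
    ... | false | true  = ⊥-elim (not-¬ (clique-⊆ X-clique Y-clique Xc Yc a Ya) Xa)

record LocalEmbedding {σ} (𝔐 𝔑 : Str σ) : Set₁ where
  field
    map             : Carrier 𝔐 → Carrier 𝔑
    Compatible      : Carrier 𝔐 → Carrier 𝔐 → Set
    compatible-refl : ∀ u → Compatible u u
    compatible-sym  : ∀ {u v} → Compatible u v → Compatible v u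
    pres-P0         : ∀ i → P0 𝔐 i ≡ P0 𝔑 i
    pres-P1         : ∀ i u → P1 𝔐 i u ≡ P1 𝔑 i (map u)
    pres-P2         : ∀ {u v} → Compatible u v → ∀ r → P2 𝔐 r u v ≡ P2 𝔑 r (map u) (map v)
    injective       : ∀ {u v} → Compatible u v → map u ≡ map v → u ≡ v

module LocalEmbeddingProperties {σ} {𝔐 𝔑 : Str σ} (E : LocalEmbedding 𝔐 𝔑) where
  open LocalEmbedding E

  T-map : ∀ {u v} → Compatible u v → T 𝔐 u v ≡ T 𝔑 (map u) (map v)
  T-map c = pres-P2 c (Tsym {σ})

  T-trans-pullback : Transitive 𝔑 → ∀ {u v w} → Compatible u v → Compatible v w → Compatible u w
                   → T 𝔐 u v ≡ true → T 𝔐 v w ≡ true → T 𝔐 u w ≡ true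
  T-trans-pullback T-trans cuv cvw cuw Tuv Tvw = trans (T-map cuw)
    (T-trans _ _ _ (trans (sym (T-map cuv)) Tuv) (trans (sym (T-map cvw)) Tvw))

  ⟦⟧-map : ∀ {u v} → Compatible u v → ∀ φ → ⟦ φ ⟧ 𝔐 u v ⇔ ⟦ φ ⟧ 𝔑 (map u) (map v)
  ⟦⟧-map {u} {v} c = go
    where
    go : ∀ φ → ⟦ φ ⟧ 𝔐 u v ⇔ ⟦ φ ⟧ 𝔑 (map u) (map v)
    go ⊤ᶠ             = ⇔-id _
    go (at0 p)        = ≡⇒≡true-⇔ (pres-P0 p)
    go (at1 p vx)     = ≡⇒≡true-⇔ (pres-P1 p u)
    go (at1 p vy)     = ≡⇒≡true-⇔ (pres-P1 p v)
    go (at2 r vx vx)  = ≡⇒≡true-⇔ (pres-P2 (compatible-refl u) r)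
    go (at2 r vx vy)  = ≡⇒≡true-⇔ (pres-P2 c r)
    go (at2 r vy vx)  = ≡⇒≡true-⇔ (pres-P2 (compatible-sym c) r)
    go (at2 r vy vy)  = ≡⇒≡true-⇔ (pres-P2 (compatible-refl v) r)
    go (eqᶠ vx vx)    = mk⇔ (λ _ → refl) (λ _ → refl)
    go (eqᶠ vy vy)    = mk⇔ (λ _ → refl) (λ _ → refl)
    go (eqᶠ vx vy)    = mk⇔ (cong map) (injective c)
    go (eqᶠ vy vx)    = mk⇔ (cong map) (injective (compatible-sym c))
    go (¬ᶠ φ)         = ¬-cong-⇔ (go φ)
    go (φ ∧ᶠ ψ)       = go φ ×-⇔ go ψ
    go (φ ∨ᶠ ψ)       = go φ ⊎-⇔ go ψ

  tp1-map : ∀ u → tp1 𝔐 u ≡ tp1 𝔑 (map u)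
  tp1-map u = cong₂ _,_ (tabulate-cong pres-P0)
    (cong₂ _,_ (tabulate-cong (λ i → pres-P1 i u)) (tabulate-cong (pres-P2 (compatible-refl u))))

  tp2-map : ∀ {u v} → Compatible u v → tp2 𝔐 u v ≡ tp2 𝔑 (map u) (map v)
  tp2-map {u} {v} c = cong₂ _,_ (tp1-map u) (cong₂ _,_ (tp1-map v)
    (cong₂ _,_ (tabulate-cong (pres-P2 c)) (tabulate-cong (pres-P2 (compatible-sym c)))))

  ≺-map : ∀ {u v} → Compatible u v → _≺_ 𝔐 u v ⇔ _≺_ 𝔑 (map u) (map v)
  ≺-map c = ≡⇒≡true-⇔ (T-map c) ×-⇔ ≡⇒≡false-⇔ (T-map (compatible-sym c))

  Precedes-map : ∀ dir {u v} → Compatible u v → Precedes 𝔐 dir u v ⇔ Precedes 𝔑 dir (map u) (map v)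
  Precedes-map ⇒ c = ≺-map c
  Precedes-map ⇐ c = ≺-map (compatible-sym c)

  Linked-map : ∀ {u v} → Compatible u v → Linked 𝔐 u v → Linked 𝔑 (map u) (map v)
  Linked-map c (Tuv , Tvu) = trans (sym (T-map c)) Tuv , trans (sym (T-map (compatible-sym c))) Tvu

  Into : Subset 𝔐 → Subset 𝔑 → Set
  Into X' X = ∀ u → X' u ≡ true → X (map u) ≡ true

  Covers : Subset 𝔐 → Subset 𝔑 → Set
  Covers X' X = ∀ a → X a ≡ true → ∃[ u ] (X' u ≡ true × map u ≡ a)

  Onto : Subset 𝔐 → Subset 𝔑 → Set
  Onto X' X = Into X' X × Covers X' X

  AllCompatible : Subset 𝔐 → Subset 𝔐 → Set
  AllCompatible X' Y' = ∀ u v → X' u ≡ true → Y' v ≡ true → Compatible u v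

  TConnected-pullback : ∀ {X' X} → Into X' X → AllCompatible X' X'
                      → TConnected 𝔑 X → TConnected 𝔐 X'
  TConnected-pullback into compat connected u v X'u X'v u≢v =
    trans (T-map c) (connected (map u) (map v) (into u X'u) (into v X'v) (u≢v ∘ injective c))
    where c = compat u v X'u X'v

  Onto⇒Iso : ∀ {X' X} → Onto X' X → AllCompatible X' X' → Iso 𝔐 X' 𝔑 X
  Onto⇒Iso (into , covered) compat = record
    { to      = λ (u , X'u) → map u , into u X'u
    ; from    = λ (a , Xa) → let (u , X'u , _) = covered a Xa in u , X'u
    ; from-to = λ (u , X'u) → let (v , X'v , e) = covered (map u) (into u X'u)
                              in injective (compat v u X'v X'u) e
    ; to-from = λ (a , Xa) → proj₂ (proj₂ (covered a Xa))
    ; pres0   = λ i → sym (pres-P0 i)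
    ; pres1   = λ i (u , _) → sym (pres-P1 i u)
    ; pres2   = λ r (u , X'u) (v , X'v) → sym (pres-P2 (compat u v X'u X'v) r) }

  𝓑-map : ∀ {X' Y' X Y} → Onto X' X → Onto Y' Y → AllCompatible X' Y' → 𝓑 𝔐 X' Y' ≐ 𝓑 𝔑 X Y
  𝓑-map {X'} {Y'} {X} {Y} (X'→X , X-covered) (Y'→Y , Y-covered) compat _ = image , preimage
    where
    image : ∀ {t} → 𝓑 𝔐 X' Y' t → 𝓑 𝔑 X Y t
    image (u , v , X'u , Y'v , u≢v , refl) =
      map u , map v , X'→X u X'u , Y'→Y v Y'v , u≢v ∘ injective c , sym (tp2-map c)
      where c = compat u v X'u Y'v
    preimage : ∀ {t} → 𝓑 𝔑 X Y t → 𝓑 𝔐 X' Y' t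
    preimage (a , b , Xa , Yb , a≢b , refl) with X-covered a Xa | Y-covered b Yb
    ... | u , X'u , refl | v , Y'v , refl =
      u , v , X'u , Y'v , (λ { refl → a≢b refl }) , tp2-map (compat u v X'u Y'v)

  Bound-map : ∀ {X' X} → Covers X' X → ∀ dir {u t}
            → (∀ c → X' c ≡ true → Compatible u c)
            → (∀ c → X' c ≡ true → Precedes 𝔐 dir u c) → tp1 𝔐 u ≡ t → Bound dir 𝔑 X t
  Bound-map {X'} {X} covered dir {u} compat precedes e = map u , bound , trans (sym (tp1-map u)) e
    where
    bound : ∀ b → X b ≡ true → Precedes 𝔑 dir (map u) b
    bound b Xb with covered b Xb
    ... | c , X'c , refl = to (Precedes-map dir (compat c X'c)) (precedes c X'c)

  Bound-unmap : ∀ {X' X} → Into X' X → ∀ dir {u}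
              → (∀ c → X' c ≡ true → Compatible u c)
              → (∀ b → X b ≡ true → Precedes 𝔑 dir (map u) b)
              → ∀ c → X' c ≡ true → Precedes 𝔐 dir u c
  Bound-unmap into dir compat bound c X'c =
    from (Precedes-map dir (compat c X'c)) (bound (map c) (into c X'c))

  image-absorbed : Transitive 𝔑 → ∀ {X' X} → Covers X' X → IsClique 𝔑 X → ∀ {w u} → X w ≡ true
                 → (∀ c → X' c ≡ true → Compatible u c)
                 → (∀ c → X' c ≡ true → c ≢ u → Linked 𝔐 u c) → X (map u) ≡ true
  image-absorbed T-trans covered X-clique Xw compat linked =
    clique-absorb 𝔑 T-trans X-clique Xw λ b Xb b≢mapu → case covered b Xb of λ where
      (c , X'c , refl) → Linked-map (compat c X'c) (linked c X'c λ { refl → b≢mapu refl })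

module Extension {σ} (𝔄 : Str σ) (B B1 : Subset 𝔄) (𝔇 : Str σ)
                 (f : Iso 𝔇 (full 𝔇) 𝔄 B) (f1 : Iso 𝔇 (full 𝔇) 𝔄 B1)
                 (T-trans : Transitive 𝔄) (B-clique : IsClique 𝔄 B) (B1-clique : IsClique 𝔄 B1)
                 (B≠B1 : Distinct 𝔄 B B1) where

  open Plus 𝔄 B 𝔇 f f1

  disjoint : ∀ {a} → B a ≡ true → B1 a ≡ true → ⊥
  disjoint Ba B1a = B≠B1 (cliques-meeting-coincide 𝔄 T-trans B-clique B1-clique Ba B1a)

  copy : Bool → Subset 𝔄
  copy true  = B1
  copy false = B

  copy-clique : ∀ s → IsClique 𝔄 (copy s)
  copy-clique true  = B1-clique
  copy-clique false = B-clique

  embedding : ∀ s → Iso 𝔇 (full 𝔇) 𝔄 (copy s)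
  embedding true  = f1
  embedding false = f

  module Copy (s : Bool) = FullIso (embedding s)

  ∉-own-copy : ∀ s {a} → B a ≡ s → copy s a ≡ true → ⊥
  ∉-own-copy true  Ba B1a = disjoint Ba B1a
  ∉-own-copy false Ba Ba' = not-¬ Ba' Ba

  ρ : Bool → Carrier 𝔄⁺ → Carrier 𝔄
  ρ s (inj₁ a) = a
  ρ s (inj₂ x) = Copy.ι s x

  Compatible : Bool → Carrier 𝔄⁺ → Carrier 𝔄⁺ → Set
  Compatible s (inj₁ _) (inj₁ _) = ⊤
  Compatible s (inj₂ _) (inj₂ _) = ⊤
  Compatible s (inj₂ _) (inj₁ a) = B a ≡ s
  Compatible s (inj₁ a) (inj₂ _) = B a ≡ s

  Compatible-refl : ∀ {s} u → Compatible s u u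
  Compatible-refl (inj₁ _) = tt
  Compatible-refl (inj₂ _) = tt

  Compatible-sym : ∀ {s u v} → Compatible s u v → Compatible s v u
  Compatible-sym {u = inj₁ _} {inj₁ _} c = c
  Compatible-sym {u = inj₁ _} {inj₂ _} c = c
  Compatible-sym {u = inj₂ _} {inj₁ _} c = c
  Compatible-sym {u = inj₂ _} {inj₂ _} c = c

  ρ-pres-P1 : ∀ s i u → p1 i u ≡ P1 𝔄 i (ρ s u)
  ρ-pres-P1 s i (inj₁ a) = refl
  ρ-pres-P1 s i (inj₂ x) = sym (Copy.ι-pres1 s i x)

  ρ-pres-P2 : ∀ s {u v} → Compatible s u v → ∀ r → p2 r u v ≡ P2 𝔄 r (ρ s u) (ρ s v)
  ρ-pres-P2 s     {inj₁ a} {inj₁ b} c r = refl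
  ρ-pres-P2 s     {inj₂ x} {inj₂ y} c r = sym (Copy.ι-pres2 s r x y)
  ρ-pres-P2 true  {inj₂ x} {inj₁ a} c r rewrite c = refl
  ρ-pres-P2 false {inj₂ x} {inj₁ a} c r rewrite c = refl
  ρ-pres-P2 true  {inj₁ a} {inj₂ x} c r rewrite c = refl
  ρ-pres-P2 false {inj₁ a} {inj₂ x} c r rewrite c = refl

  ρ-injective : ∀ s {u v} → Compatible s u v → ρ s u ≡ ρ s v → u ≡ v
  ρ-injective s {inj₁ a} {inj₁ b} c e = cong inj₁ e
  ρ-injective s {inj₂ x} {inj₂ y} c e = cong inj₂ (Copy.ι-injective s e)
  ρ-injective s {inj₂ x} {inj₁ a} c e =
    ⊥-elim (∉-own-copy s c (subst (λ z → copy s z ≡ true) e (Copy.ι∈ s x)))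
  ρ-injective s {inj₁ a} {inj₂ x} c e =
    ⊥-elim (∉-own-copy s c (subst (λ z → copy s z ≡ true) (sym e) (Copy.ι∈ s x)))

  view : Bool → LocalEmbedding 𝔄⁺ 𝔄
  view s = record
    { map = ρ s ; Compatible = Compatible s
    ; compatible-refl = Compatible-refl ; compatible-sym = Compatible-sym
    ; pres-P0 = λ _ → refl ; pres-P1 = ρ-pres-P1 s ; pres-P2 = ρ-pres-P2 s
    ; injective = ρ-injective s }

  module View (s : Bool) = LocalEmbeddingProperties (view s)

  compatible : ∀ u v → ∃[ s ] Compatible s u v
  compatible (inj₁ _) (inj₁ _) = true , tt
  compatible (inj₂ _) (inj₂ _) = true , tt
  compatible (inj₂ _) (inj₁ a) = B a , refl
  compatible (inj₁ a) (inj₂ _) = B a , refl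

  Compatible-inj₁ : ∀ {s} u {b} → B b ≡ s → Compatible s u (inj₁ b)
  Compatible-inj₁ (inj₁ _) _  = tt
  Compatible-inj₁ (inj₂ _) Bb = Bb

  Compatible-D : ∀ a c → Dˢ c ≡ true → Compatible (B a) (inj₁ a) c
  Compatible-D a (inj₂ _) _ = refl

  Disjoint-from-D : Subset 𝔄⁺ → Set
  Disjoint-from-D Z = ∀ x → Z (inj₂ x) ≡ false

  Compatible-into : ∀ s Z → Disjoint-from-D Z → (∀ b → Z (inj₁ b) ≡ true → B b ≡ s)
            → ∀ u v → Z v ≡ true → Compatible s u v
  Compatible-into s Z Z∩D=∅ Z⊆ u (inj₁ b) Zb = Compatible-inj₁ u (Z⊆ b Zb)
  Compatible-into s Z Z∩D=∅ Z⊆ u (inj₂ x) Zx = ⊥-elim (not-¬ Zx (Z∩D=∅ x))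

  D-onto : ∀ s → View.Onto s Dˢ (copy s)
  D-onto s = into , covered
    where
    into : View.Into s Dˢ (copy s)
    into (inj₂ x) _ = Copy.ι∈ s x
    covered : View.Covers s Dˢ (copy s)
    covered a Xa = let (x , e) = Copy.ι-surjective s Xa in inj₂ x , refl , e

  restrict-onto : ∀ s Z → Disjoint-from-D Z → View.Onto s Z (restrict Z)
  restrict-onto s Z Z∩D=∅ = into , λ a Za → inj₁ a , Za , refl
    where
    into : View.Into s Z (restrict Z)
    into (inj₁ a) Za = Za
    into (inj₂ x) Zx = ⊥-elim (not-¬ Zx (Z∩D=∅ x))

  lift-onto : ∀ s Y → View.Onto s (lift Y) Y
  lift-onto s Y = restrict-onto s (lift Y) (λ _ → refl)

  Compatible-into-liftB : ∀ u v → lift B v ≡ true → Compatible true u v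
  Compatible-into-liftB = Compatible-into true (lift B) (λ _ → refl) (λ _ Bb → Bb)

  holds-via : ∀ s {u v} → Compatible s u v → ∀ φ → ⟦ φ ⟧ 𝔄 (ρ s u) (ρ s v) → ⟦ φ ⟧ 𝔄⁺ u v
  holds-via s c φ = from (View.⟦⟧-map s c φ)

  private
    B-connected = proj₁ B-clique

  T⁺-trans-via : ∀ s {u v w} → Compatible s u v → Compatible s v w → Compatible s u w
               → T 𝔄⁺ u v ≡ true → T 𝔄⁺ v w ≡ true → T 𝔄⁺ u w ≡ true
  T⁺-trans-via s = View.T-trans-pullback s T-trans

  -- Only triples with one inj₂ and two inj₁ on different sides of B escape a single view.
  T⁺-trans : Transitive 𝔄⁺
  T⁺-trans (inj₁ a) (inj₁ b) (inj₁ c) = T-trans a b c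
  T⁺-trans u@(inj₂ _) v@(inj₂ _) w@(inj₂ _) = T⁺-trans-via true {u} {v} {w} tt tt tt
  T⁺-trans u@(inj₁ a) v@(inj₂ _) w@(inj₂ _) = T⁺-trans-via (B a) {u} {v} {w} refl tt refl
  T⁺-trans u@(inj₂ _) v@(inj₁ a) w@(inj₂ _) = T⁺-trans-via (B a) {u} {v} {w} refl refl tt
  T⁺-trans u@(inj₂ _) v@(inj₂ _) w@(inj₁ a) = T⁺-trans-via (B a) {u} {v} {w} tt refl refl
  T⁺-trans (inj₂ d) (inj₁ a) (inj₁ b) p q with B a in Ba | B b in Bb
  ... | true  | true  = T-trans _ a b p q
  ... | false | false = T-trans _ a b p q
  ... | true  | false = T-connectedˡ 𝔄 B-connected T-trans (Copy.ι∈ false d) Ba q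
  ... | false | true  =
    ⊥-elim (not-¬ (clique-convex 𝔄 T-trans B-clique (Copy.ι∈ false d) Bb p q) Ba)
  T⁺-trans (inj₁ a) (inj₂ d) (inj₁ b) p q with B a in Ba | B b in Bb
  ... | true  | true  = T-trans a _ b p q
  ... | false | false = T-trans a _ b p q
  ... | true  | false = T-connectedˡ 𝔄 B-connected T-trans Ba (Copy.ι∈ false d) q
  ... | false | true  = T-connectedʳ 𝔄 B-connected T-trans (Copy.ι∈ false d) Bb p
  T⁺-trans (inj₁ a) (inj₁ b) (inj₂ d) p q with B a in Ba | B b in Bb
  ... | true  | true  = T-trans a b _ p q
  ... | false | false = T-trans a b _ p q
  ... | true  | false =
    ⊥-elim (not-¬ (clique-convex 𝔄 T-trans B-clique Ba (Copy.ι∈ false d) p q) Bb)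
  ... | false | true  = T-connectedʳ 𝔄 B-connected T-trans Bb (Copy.ι∈ false d) p

  ⊨-extension : ∀ {Ψ} → 𝔄 ⊨ Ψ → 𝔄⁺ ⊨ Ψ
  ⊨-extension {Ψ} (_ , ψ0-holds , γ-holds , δ-holds) = T⁺-trans , ψ0⁺ , γ⁺ , δ⁺
    where
    ψ0⁺ : ∀ u v → ⟦ ψ0 Ψ ⟧ 𝔄⁺ u v
    ψ0⁺ u v = let (s , c) = compatible u v in holds-via s c (ψ0 Ψ) (ψ0-holds _ _)

    γ⁺ : ∀ i u → ∃[ v ] ⟦ γψ Ψ i ^[ d Ψ i ] ⟧ 𝔄⁺ u v
    γ⁺ i (inj₁ a) = let (b , h) = γ-holds i a in inj₁ b , holds-via true tt (γψ Ψ i ^[ d Ψ i ]) h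
    γ⁺ i (inj₂ x) = let (b , h) = γ-holds i (Copy.ι false x) in inj₁ b ,
      holds-via false (strict-witness-∉ 𝔄 B-connected (d Ψ i) (γψ Ψ i) h (Copy.ι∈ false x))
        (γψ Ψ i ^[ d Ψ i ]) h

    -- A ↔-witness of an element of B lies in B, hence has a copy in D.
    δ⁺ : ∀ i u → ∃[ v ] ⟦ δψ Ψ i ^↔ ⟧ 𝔄⁺ u v
    δ⁺ i (inj₁ a) = let (b , h) = δ-holds i a in inj₁ b , holds-via true tt (δψ Ψ i ^↔) h
    δ⁺ i (inj₂ x) with δ-holds i (Copy.ι false x)
    ... | b , h@(Txb , Tbx , _) with Copy.ι-surjective false
      (clique-convex 𝔄 T-trans B-clique (Copy.ι∈ false x) (Copy.ι∈ false x) Txb Tbx)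
    ... | y , refl = inj₂ y , holds-via false tt (δψ Ψ i ^↔) h

  meets-D : ∀ {Ψ} i a → B a ≡ false → Meets Ψ 𝔄 i a B → Meets Ψ 𝔄⁺ i (inj₁ a) Dˢ
  meets-D {Ψ} i a Ba (b , Bb , _ , h) with Copy.ι-surjective false Bb
  ... | x , refl = inj₂ x , refl , (λ ()) , holds-via false Ba (γψ Ψ i ^[ d Ψ i ]) h

  Bound-inj₁ : ∀ {Z} → View.Into false Z B → ∀ dir {t} → Bound dir 𝔄 B t → Bound dir 𝔄⁺ Z t
  Bound-inj₁ into dir (a , below , e) = inj₁ a , View.Bound-unmap false into dir
    (λ c _ → Compatible-sym (Compatible-inj₁ c (Bound-∉ {X = B} dir below))) below , e

  Bound-D : SpEq 𝔄 B1 𝔄 B → ∀ dir → Bound dir 𝔄⁺ Dˢ ≐ Bound dir 𝔄 B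
  Bound-D sp dir _ = forward , Bound-inj₁ (proj₁ (D-onto false)) dir
    where
    to-B : ∀ s {t} → Bound dir 𝔄 (copy s) t → Bound dir 𝔄 B t
    to-B true  = proj₁ (SpEq-bound sp dir _)
    to-B false h = h

    forward : ∀ {t} → Bound dir 𝔄⁺ Dˢ t → Bound dir 𝔄 B t
    forward (inj₂ x , below , _) = ⊥-elim (Precedes-irrefl dir (below (inj₂ x) refl))
    forward (inj₁ a , below , e) =
      to-B (B a) (View.Bound-map (B a) (proj₂ (D-onto (B a))) dir (Compatible-D a) below e)

  Bound-liftB : ∀ dir → Bound dir 𝔄⁺ (lift B) ≐ Bound dir 𝔄 B
  Bound-liftB dir _ = forward , Bound-inj₁ (proj₁ (lift-onto false B)) dir
    where
    forward : ∀ {t} → Bound dir 𝔄⁺ (lift B) t → Bound dir 𝔄 B t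
    forward (u , below , e) = View.Bound-map true (proj₂ (lift-onto true B)) dir
      (λ c → Compatible-into-liftB u c) below e

  D-all-compatible : ∀ s → View.AllCompatible s Dˢ Dˢ
  D-all-compatible s (inj₂ _) (inj₂ _) _ _ = tt

  liftB-all-compatible : ∀ s → View.AllCompatible s (lift B) (lift B)
  liftB-all-compatible s (inj₁ _) (inj₁ _) _ _ = tt

  SpEq-D : SpEq 𝔄 B1 𝔄 B → SpEq 𝔄⁺ Dˢ 𝔄 B
  SpEq-D sp = View.Onto⇒Iso false (D-onto false) (D-all-compatible false)
            , Bound-D sp ⇒ , Bound-D sp ⇐

  SpEq-liftB : SpEq 𝔄⁺ (lift B) 𝔄 B
  SpEq-liftB = View.Onto⇒Iso false (lift-onto false B) (liftB-all-compatible false)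
             , Bound-liftB ⇒ , Bound-liftB ⇐

  𝓑-D-liftB : 𝓑 𝔄⁺ Dˢ (lift B) ≐ 𝓑 𝔄 B1 B
  𝓑-D-liftB = View.𝓑-map true (D-onto true) (lift-onto true B)
    (λ u v _ → Compatible-into-liftB u v)

  𝓑-liftB1-liftB : 𝓑 𝔄⁺ (lift B1) (lift B) ≐ 𝓑 𝔄 B1 B
  𝓑-liftB1-liftB = View.𝓑-map true (lift-onto true B1) (lift-onto true B)
    (λ u v _ → Compatible-into-liftB u v)

  D-clique : Carrier 𝔇 → IsClique 𝔄⁺ Dˢ
  D-clique x₀ = clique-intro 𝔄⁺
    (View.TConnected-pullback false (proj₁ (D-onto false)) (D-all-compatible false) B-connected)
    closed
    where
    closed : ∀ u → (∀ c → Dˢ c ≡ true → c ≢ u → Linked 𝔄⁺ u c) → Dˢ u ≡ true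
    closed (inj₂ _) _ = refl
    closed (inj₁ a) linked = ⊥-elim (∉-own-copy (B a) refl
      (View.image-absorbed (B a) T-trans (proj₂ (D-onto (B a))) (copy-clique (B a))
        (Copy.ι∈ (B a) x₀) (Compatible-D a) linked))

  liftB-clique : ∀ {b₀} → B b₀ ≡ true → IsClique 𝔄⁺ (lift B)
  liftB-clique Bb₀ = clique-intro 𝔄⁺
    (View.TConnected-pullback false (proj₁ (lift-onto false B))
      (liftB-all-compatible false) B-connected)
    closed
    where
    absorbed : ∀ u → (∀ c → lift B c ≡ true → c ≢ u → Linked 𝔄⁺ u c) → B (ρ true u) ≡ true
    absorbed u = View.image-absorbed true T-trans (proj₂ (lift-onto true B)) B-clique Bb₀
      (Compatible-into-liftB u)

    closed : ∀ u → (∀ c → lift B c ≡ true → c ≢ u → Linked 𝔄⁺ u c) → lift B u ≡ true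
    closed (inj₁ a) linked = absorbed (inj₁ a) linked
    closed (inj₂ x) linked = ⊥-elim (disjoint (absorbed (inj₂ x) linked) (Copy.ι∈ true x))

  module _ {X : Subset 𝔄⁺} (X-clique : IsClique 𝔄⁺ X)
           (X≠B : Distinct 𝔄⁺ X (lift B)) (X≠D : Distinct 𝔄⁺ X Dˢ) where

    X∩D=∅ : Disjoint-from-D X
    X∩D=∅ x = ¬-not λ Xx →
      X≠D (cliques-meeting-coincide 𝔄⁺ T⁺-trans X-clique (D-clique x) Xx refl)

    X∩B=∅ : ∀ b → X (inj₁ b) ≡ true → B b ≡ false
    X∩B=∅ b Xb = ¬-not λ Bb →
      X≠B (cliques-meeting-coincide 𝔄⁺ T⁺-trans X-clique (liftB-clique Bb) Xb Bb)

    𝓑-D-X : 𝓑 𝔄⁺ Dˢ X ≐ 𝓑 𝔄 B (restrict X)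
    𝓑-D-X = View.𝓑-map false (D-onto false) (restrict-onto false X X∩D=∅)
      (λ u v _ → Compatible-into false X X∩D=∅ X∩B=∅ u v)

    𝓑-liftB-X : 𝓑 𝔄⁺ (lift B) X ≐ 𝓑 𝔄 B (restrict X)
    𝓑-liftB-X = View.𝓑-map false (lift-onto false B) (restrict-onto false X X∩D=∅)
      (λ u v _ → Compatible-into false X X∩D=∅ X∩B=∅ u v)

claim3p11 : ∀ {σ} (Ψ : NF σ) (𝔄 : Str σ) (B B1 : Subset 𝔄)
    → 𝔄 ⊨ Ψ
    → IsClique 𝔄 B → IsClique 𝔄 B1 → Distinct 𝔄 B B1
    → SpEq 𝔄 B1 𝔄 B
    → (𝔇 : Str σ) (f : Iso 𝔇 (full 𝔇) 𝔄 B) (f1 : Iso 𝔇 (full 𝔇) 𝔄 B1)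
    → let open Plus 𝔄 B 𝔇 f f1 in
      (𝔄⁺ ⊨ Ψ)
      × (∀ (i : Fin (m Ψ)) a → B a ≡ false → Meets Ψ 𝔄 i a B → Meets Ψ 𝔄⁺ i (inj₁ a) Dˢ)
      × (SpEq 𝔄⁺ Dˢ 𝔄⁺ (lift B) × SpEq 𝔄⁺ (lift B) 𝔄 B)
      × ((𝓑 𝔄⁺ Dˢ (lift B) ≐ 𝓑 𝔄⁺ (lift B1) (lift B))
         × (𝓑 𝔄⁺ (lift B1) (lift B) ≐ 𝓑 𝔄 B1 B))
      × (∀ (X : Subset 𝔄⁺) → IsClique 𝔄⁺ X → Distinct 𝔄⁺ X (lift B) → Distinct 𝔄⁺ X Dˢ
         → (𝓑 𝔄⁺ Dˢ X ≐ 𝓑 𝔄⁺ (lift B) X)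
           × (𝓑 𝔄⁺ (lift B) X ≐ 𝓑 𝔄 B (restrict X)))
claim3p11 Ψ 𝔄 B B1 ⊨Ψ B-clique B1-clique B≠B1 sp 𝔇 f f1 =
    ⊨-extension ⊨Ψ
  , meets-D {Ψ}
  , (SpEq-trans (SpEq-D sp) (SpEq-sym SpEq-liftB) , SpEq-liftB)
  , (≐-trans 𝓑-D-liftB (≐-sym 𝓑-liftB1-liftB) , 𝓑-liftB1-liftB)
  , λ X X-clique X≠B X≠D →
      ≐-trans (𝓑-D-X X-clique X≠B X≠D) (≐-sym (𝓑-liftB-X X-clique X≠B X≠D))
    , 𝓑-liftB-X X-clique X≠B X≠D
  where open Extension 𝔄 B B1 𝔇 f f1 (proj₁ ⊨Ψ) B-clique B1-clique B≠B1
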